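{- Let $\gamma$ be a countable limit ordinal, $\langle\delta_n:n\in\omega\rangle$ an increasing sequence cofinal in $\gamma\setminus\{0\}$, $\mathbb L=\langle L,<\rangle=\sum_{n\in\omega}\langle L_n,<_n\rangle$ with pairwise disjoint $L_n$ and $\langle L_n,<_n\rangle\cong\langle\omega^{\delta_n},\in\rangle$, $\mathcal I=\{A\subset L:\mathbb L\not\hookrightarrow A\}$, and $\mathrm{supp}A=\{n\in\omega:A\cap L_n\neq\emptyset\}$. Let $G\subset P(\omega)$ be an ultrafilter and $\mathcal I_G=\{A\subset L:\exists I\in\mathcal I\;\mathrm{supp}(A\setminus I)\notin G\}$. Then (a) $\mathcal I_G$ is an ideal and $\mathcal I\subset\mathcal I_G$; (b) $\mathrm{sm}\langle P(L)\setminus\mathcal I_G,\subset_{\mathcal I}\rangle=\langle P(L)\setminus\mathcal I_G,\subset_{\mathcal I_G}\rangle$.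
   Context: For an ideal $\mathcal J$ on $L$, $A\subset_{\mathcal J}B$ iff $A\setminus B\in\mathcal J$. For a pre-order $\langle P,\le\rangle$, its separative modification $\mathrm{sm}\langle P,\le\rangle$ is $\langle P,\le^*\rangle$, where $p\le^*q$ iff $\forall r\le p\;\exists s\le r\;s\le q$ (here $r,s$ range over $P$). -}

module Defs where

open import Level using (0ℓ; suc)
import Level
open import Data.Nat as ℕ using (ℕ)
open import Data.Product using (Σ; Σ-syntax; ∃; _×_; _,_)
open import Data.Sum using (_⊎_)
open import Data.Empty using (⊥)
open import Data.Unit using (⊤)
open import Data.List using (List; []; _∷_)
open import Data.List.Relation.Unary.All using (All)
open import Relation.Nullary using (¬_)
open import Relation.Unary using (Pred; _⊆_; _∪_; _∩_; ∁)
open import Relation.Binary using (Rel)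
open import Relation.Binary.PropositionalEquality using (_≡_)

-- Ordinals below a countable ordinal γ are represented by elements of a
-- countable well-ordered set Γ (an element β stands for the ordinal
-- that is the order type of {α ∈ Γ : α < β}).
--
-- ω^β is represented by its Cantor normal forms: finite non-increasing
-- lists α₁ ≥ α₂ ≥ … ≥ αₖ of ordinals < β (standing for
-- ω^α₁ + … + ω^αₖ), ordered lexicographically (a proper prefix is
-- smaller).

module _ {Γ : Set} (_<_ : Rel Γ 0ℓ) where

  data NonIncr : List Γ → Set where
    []   : NonIncr []
    [_]  : ∀ x → NonIncr (x ∷ [])
    cons : ∀ {x y l} → ¬ (x < y) → NonIncr (y ∷ l) → NonIncr (x ∷ y ∷ l)

  IsCNF : Γ → List Γ → Set
  IsCNF β l = All (_< β) l × NonIncr l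

  data _<ᴸ_ : List Γ → List Γ → Set where
    nil<  : ∀ {y ys} → [] <ᴸ (y ∷ ys)
    head< : ∀ {x y xs ys} → x < y → (x ∷ xs) <ᴸ (y ∷ ys)
    tail< : ∀ {x xs ys} → xs <ᴸ ys → (x ∷ xs) <ᴸ (x ∷ ys)

  record IsoToOmegaPow (A : Set) (_<A_ : Rel A 0ℓ) (β : Γ) : Set where
    field
      φ        : A → List Γ
      into     : ∀ x → IsCNF β (φ x)
      onto     : ∀ l → IsCNF β l → Σ A (λ x → φ x ≡ l)
      injective : ∀ x y → φ x ≡ φ y → x ≡ y
      preserve : ∀ x y → x <A y → φ x <ᴸ φ y
      reflect  : ∀ x y → φ x <ᴸ φ y → x <A y

-- The ordered sum 𝕃 = Σ_{n∈ω} ⟨L_n,<_n⟩, realised on the disjoint union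
-- L = Σ ℕ Ln (so that L_n = {n} × Ln n).

module _ (Ln : ℕ → Set) (_<n_ : ∀ n → Rel (Ln n) 0ℓ) where

  L : Set
  L = Σ ℕ Ln

  data _<Σ_ : L → L → Set where
    diff : ∀ {m n x y} → m ℕ.< n → (m , x) <Σ (n , y)
    same : ∀ {n x y} → _<n_ n x y → (n , x) <Σ (n , y)

  Embeds : Pred L 0ℓ → Set
  Embeds A = Σ (L → L) λ f →
    (∀ x y → x <Σ y → f x <Σ f y) × (∀ x y → f x <Σ f y → x <Σ y) × (∀ x → A (f x))

  𝓘 : Pred (Pred L 0ℓ) 0ℓ
  𝓘 A = ¬ Embeds A

  supp : Pred L 0ℓ → Pred ℕ 0ℓ
  supp A n = Σ (Ln n) λ x → A (n , x)

  _∖_ : Pred L 0ℓ → Pred L 0ℓ → Pred L 0ℓ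
  A ∖ B = λ x → A x × ¬ B x

  𝓘[_] : Pred (Pred ℕ 0ℓ) 0ℓ → Pred (Pred L 0ℓ) (suc 0ℓ)
  𝓘[ G ] A = Σ (Pred L 0ℓ) λ I → 𝓘 I × ¬ G (supp (A ∖ I))

  _⊂[_]_ : ∀ {ℓ} → Pred L 0ℓ → Pred (Pred L 0ℓ) ℓ → Pred L 0ℓ → Set ℓ
  A ⊂[ 𝒥 ] B = 𝒥 (A ∖ B)

record IsIdeal {X : Set} {ℓ} (𝒥 : Pred (Pred X 0ℓ) ℓ) : Set (suc 0ℓ Level.⊔ ℓ) where
  field
    empty   : 𝒥 (λ _ → ⊥)
    down    : ∀ A B → B ⊆ A → 𝒥 A → 𝒥 B
    union   : ∀ A B → 𝒥 A → 𝒥 B → 𝒥 (A ∪ B)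
    proper  : ¬ 𝒥 (λ _ → ⊤)

record IsUltrafilter (G : Pred (Pred ℕ 0ℓ) 0ℓ) : Set (suc 0ℓ) where
  field
    full    : G (λ _ → ⊤)
    noEmpty : ¬ G (λ _ → ⊥)
    up      : ∀ A B → A ⊆ B → G A → G B
    inter   : ∀ A B → G A → G B → G (A ∩ B)
    ultra   : ∀ A → G A ⊎ G (∁ A)

NonPrincipal : Pred (Pred ℕ 0ℓ) 0ℓ → Set
NonPrincipal G = ∀ m → ¬ G (λ k → k ≡ m)

sm-≤ : ∀ {T : Set₁} {ℓ ℓ'} (P : Pred T ℓ) (_≤_ : T → T → Set ℓ') → T → T → Set _
sm-≤ {T} P _≤_ p q = ∀ r → P r → r ≤ p → Σ T λ s → P s × s ≤ r × s ≤ q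

module Submission where

-- 𝕃 is indivisible: whenever L is split into two parts, one of them contains a copy of 𝕃. For a summand ω^β
-- this is proved by induction on β: ω^β embeds into, and is embedded by, an ω-sum of powers ω^θₖ with θₖ < β
-- (θₖ = α for β = α + 1, θₖ cofinal in β for limit β), and an ω-sum of indivisible orders, each embedding into
-- the later ones, is indivisible, because infinitely many summands share a side of the partition. The same
-- argument applied to 𝕃 = Σₙ Lₙ makes 𝕃 indivisible, hence 𝓘 closed under unions. As G is non-principal, its
-- sets are infinite, and 𝕃 embeds into any union of infinitely many summands; so 𝓘_G is proper. For (b),
-- p ∖ q ∈ 𝓘_G gives p ≤* q because every 𝓘_G-positive r shrinks, by discarding a G-small set of summands, to
-- an 𝓘_G-positive s with s ∖ q ∈ 𝓘; the converse is immediate.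

open import Defs
open import Level using (0ℓ; suc; Lift; lift; lower)
open import Data.Nat using (ℕ; zero; z≤n; s≤s; z<s; s<s)
import Data.Nat as ℕ
import Data.Nat.Properties as ℕₚ
open import Data.Nat.InfinitelyOften using (Inf; commutes-with-∪)
import Data.Nat.InfinitelyOften as InfinitelyOften
open import Data.Product using (Σ; ∃; _×_; _,_; proj₁; proj₂)
import Data.Product as Product
open import Data.Product.Relation.Binary.Lex.Strict using (×-Lex)
open import Data.Sum using (_⊎_; inj₁; inj₂; [_,_]′)
import Data.Sum as Sum
open import Data.Empty using (⊥; ⊥-elim)
open import Data.Unit using (⊤; tt)
open import Data.List using (List; []; _∷_; _++_; replicate)
open import Data.List.Relation.Unary.All as All using (All; []; _∷_)
open import Data.List.Relation.Unary.All.Properties using (++⁺; replicate⁺)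
open import Function using (_∘_; id; _on_)
open import Relation.Nullary using (¬_; Dec; yes; no)
open import Relation.Nullary.Decidable using (map′; decidable-stable)
open import Relation.Unary using (Pred; _⊆_; _∪_; _∩_; ∁)
import Relation.Unary as Unary
open import Relation.Binary using (Rel; IsStrictTotalOrder; tri<; tri≈; tri>; _Preserves_⟶_; Transitive; Asymmetric)
open import Relation.Binary.PropositionalEquality using (_≡_; refl; sym; cong; subst; subst₂)
open import Induction.WellFounded using (WellFounded)
import Induction.WellFounded as WF
open import Function.Bundles using (_⇔_; mk⇔)
open import Axiom.ExcludedMiddle using (ExcludedMiddle)

chain⇒strictMono : ∀ {A : Set} {R : Rel A 0ℓ} → Transitive R → (f : ℕ → A) →
                   (∀ k → R (f k) (f (ℕ.suc k))) → f Preserves ℕ._<_ ⟶ R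
chain⇒strictMono {R = R} R-trans f step {k} {ℕ.suc k'} k<1+k' with ℕₚ.m<1+n⇒m<n∨m≡n k<1+k'
... | inj₁ k<k' = R-trans (chain⇒strictMono {R = R} R-trans f step {k} {k'} k<k') (step k')
... | inj₂ refl = step k

chain⇒segment-⊆ : ∀ {A : Set} {R : Rel A 0ℓ} → Transitive R → (f : ℕ → A) →
                  (∀ k → R (f k) (f (ℕ.suc k))) → ∀ {k k'} → k ℕ.≤ k' → ∀ {a} → R a (f k) → R a (f k')
chain⇒segment-⊆ {R = R} R-trans f step {k} {k'} k≤k' a<fk with ℕₚ.m≤n⇒m<n∨m≡n k≤k'
... | inj₁ k<k' = R-trans a<fk (chain⇒strictMono {R = R} R-trans f step {k} {k'} k<k')
... | inj₂ refl = a<fk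

least : ∀ {P : Pred ℕ 0ℓ} → Unary.Decidable P → ∀ {n} → P n →
        ∃ λ k → P k × ∀ j → P j → k ℕ.≤ j
least P? {zero} P0 = 0 , P0 , λ _ _ → z≤n
least P? {ℕ.suc n} Pn with P? 0
... | yes P0 = 0 , P0 , λ _ _ → z≤n
... | no ¬P0 with least (P? ∘ ℕ.suc) Pn
...   | k , Pk , k-min = ℕ.suc k , Pk , λ where
          zero P0 → ⊥-elim (¬P0 P0)
          (ℕ.suc j) Pj → s≤s (k-min j Pj)

strictMono⇒reflects : ∀ {A B : Set} {_<A_ : Rel A 0ℓ} {_<B_ : Rel B 0ℓ} →
                      (∀ x y → x <A y ⊎ x ≡ y ⊎ y <A x) → Asymmetric _<B_ →
                      (f : A → B) → f Preserves _<A_ ⟶ _<B_ → ∀ {x y} → f x <B f y → x <A y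
strictMono⇒reflects connected asym f f-mono {x} {y} fx<fy with connected x y
... | inj₁ x<y = x<y
... | inj₂ (inj₁ refl) = ⊥-elim (asym fx<fy fx<fy)
... | inj₂ (inj₂ y<x) = ⊥-elim (asym fx<fy (f-mono y<x))

module SumOrder {X : ℕ → Set} {_<X_ : ∀ k → Rel (X k) 0ℓ} where

  <Σ-asym : (∀ {k} → Asymmetric (_<X_ k)) → Asymmetric (_<Σ_ X _<X_)
  <Σ-asym _    (diff p) (diff q) = ℕₚ.<-asym p q
  <Σ-asym _    (diff p) (same _) = ℕₚ.<-irrefl refl p
  <Σ-asym _    (same _) (diff q) = ℕₚ.<-irrefl refl q
  <Σ-asym asym (same p) (same q) = asym p q

  <Σ-connected : (∀ {k} (x y : X k) → _<X_ k x y ⊎ x ≡ y ⊎ _<X_ k y x) →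
                 ∀ u v → _<Σ_ X _<X_ u v ⊎ u ≡ v ⊎ _<Σ_ X _<X_ v u
  <Σ-connected connected (m , x) (n , y) with ℕₚ.<-cmp m n
  ... | tri< m<n _ _ = inj₁ (diff m<n)
  ... | tri> _ _ n<m = inj₂ (inj₂ (diff n<m))
  ... | tri≈ _ refl _ = Sum.map same (Sum.map (cong (m ,_)) same) (connected x y)

SelfEmbedding : {A : Set} → Rel A 0ℓ → Pred A 0ℓ → Set
SelfEmbedding {A} _≺_ D = Σ (A → A) λ e → e Preserves _≺_ ⟶ _≺_ × (∀ x → D (e x))

Indivisible : {A : Set} → Rel A 0ℓ → Set₁
Indivisible _≺_ = ∀ D → SelfEmbedding _≺_ D ⊎ SelfEmbedding _≺_ (∁ D)

equimorphic-indivisible : ∀ {A B : Set} {_<A_ : Rel A 0ℓ} {_<B_ : Rel B 0ℓ}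
  (f : A → B) → f Preserves _<A_ ⟶ _<B_ → (g : B → A) → g Preserves _<B_ ⟶ _<A_ →
  Indivisible _<B_ → Indivisible _<A_
equimorphic-indivisible {_<A_ = _<A_} {_<B_} f f-mono g g-mono B-indivisible D =
  Sum.map (transport D) (transport (∁ D)) (B-indivisible (D ∘ g))
  where
  transport : ∀ E → SelfEmbedding _<B_ (E ∘ g) → SelfEmbedding _<A_ E
  transport E (e , e-mono , e-in) = g ∘ e ∘ f , (λ x<y → g-mono (e-mono (f-mono x<y))) , e-in ∘ f

module Classical (em : ExcludedMiddle (suc 0ℓ)) where

  decide : (P : Set) → Dec P
  decide P = map′ lower lift (em {Lift (suc 0ℓ) P})

  dne : {P : Set} → ¬ ¬ P → P
  dne {P} = decidable-stable (decide P)

  dne₁ : {P : Set₁} → ¬ ¬ P → P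
  dne₁ = decidable-stable em

  pigeonhole : ∀ {P Q : Pred ℕ 0ℓ} → (∀ n → P n ⊎ Q n) → Inf P ⊎ Inf Q
  pigeonhole P∪Q = dne (commutes-with-∪ λ (i , fin) → fin i ℕₚ.≤-refl (P∪Q i))

  record Enumeration (P : Pred ℕ 0ℓ) : Set where
    field
      index      : ℕ → ℕ
      index-in   : ∀ k → P (index k)
      ≤-index    : ∀ k → k ℕ.≤ index k
      index-mono : index Preserves ℕ._<_ ⟶ ℕ._<_

  enumerate : ∀ {P} → Inf P → Enumeration P
  enumerate {P} inf = record
    { index = index ; index-in = index-in ; ≤-index = ≤-index
    ; index-mono = chain⇒strictMono {R = ℕ._<_} ℕₚ.<-trans index index-step }
    where
    beyond : ∀ N → ∃ λ n → N ℕ.≤ n × P n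
    beyond N = dne λ none → inf (N , λ n N≤n Pn → none (n , N≤n , Pn))
    index : ℕ → ℕ
    index zero = proj₁ (beyond 0)
    index (ℕ.suc k) = proj₁ (beyond (ℕ.suc (index k)))
    index-in : ∀ k → P (index k)
    index-in zero = proj₂ (proj₂ (beyond 0))
    index-in (ℕ.suc k) = proj₂ (proj₂ (beyond (ℕ.suc (index k))))
    index-step : ∀ k → index k ℕ.< index (ℕ.suc k)
    index-step k = proj₁ (proj₂ (beyond (ℕ.suc (index k))))
    ≤-index : ∀ k → k ℕ.≤ index k
    ≤-index zero = z≤n
    ≤-index (ℕ.suc k) = ℕₚ.≤-<-trans (≤-index k) (index-step k)

  discrete-indivisible : ∀ {A : Set} {_≺_ : Rel A 0ℓ} → (∀ {x y} → ¬ x ≺ y) → Indivisible _≺_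
  discrete-indivisible discrete D with decide (∃ D)
  ... | yes (x , Dx) = inj₁ ((λ _ → x) , (⊥-elim ∘ discrete) , λ _ → Dx)
  ... | no ¬∃D = inj₂ (id , id , λ x Dx → ¬∃D (x , Dx))

  module OmegaSum (X : ℕ → Set) (_<X_ : ∀ k → Rel (X k) 0ℓ)
    (widen : ∀ {k k'} → k ℕ.≤ k' → X k → X k')
    (widen-mono : ∀ {k k'} (k≤k' : k ℕ.≤ k') → widen k≤k' Preserves _<X_ k ⟶ _<X_ k') where

    SummandEmbeds : Pred (L X _<X_) 0ℓ → Pred ℕ 0ℓ
    SummandEmbeds D k = SelfEmbedding (_<X_ k) (λ x → D (k , x))

    Inf-summands⇒SelfEmbedding : ∀ D → Inf (SummandEmbeds D) → SelfEmbedding (_<Σ_ X _<X_) D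
    Inf-summands⇒SelfEmbedding D inf = f , f-mono , f-in
      where
      open Enumeration (enumerate inf)
      f : L X _<X_ → L X _<X_
      f (k , x) = index k , proj₁ (index-in k) (widen (≤-index k) x)
      f-mono : f Preserves _<Σ_ X _<X_ ⟶ _<Σ_ X _<X_
      f-mono (diff k<k') = diff (index-mono k<k')
      f-mono (same {k} x<y) = same (proj₁ (proj₂ (index-in k)) (widen-mono (≤-index k) x<y))
      f-in : ∀ u → D (f u)
      f-in (k , x) = proj₂ (proj₂ (index-in k)) _

    sum-indivisible : (∀ k → Indivisible (_<X_ k)) → Indivisible (_<Σ_ X _<X_)
    sum-indivisible summand-indivisible D =
      Sum.map (Inf-summands⇒SelfEmbedding D) (Inf-summands⇒SelfEmbedding (∁ D))
        (pigeonhole (λ k → summand-indivisible k (λ x → D (k , x))))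

module CantorNormalForm {Γ : Set} {_<_ : Rel Γ 0ℓ} (sto : IsStrictTotalOrder _≡_ _<_) where

  open IsStrictTotalOrder sto using (compare; _≟_; _<?_; irrefl; asym) renaming (trans to <-trans)

  _≼_ : Rel Γ 0ℓ
  a ≼ b = ¬ b < a

  ≼-refl : ∀ {a} → a ≼ a
  ≼-refl = irrefl refl

  <⇒≼ : ∀ {a b} → a < b → a ≼ b
  <⇒≼ = asym

  ≼-<-trans : ∀ {a b c} → a ≼ b → b < c → a < c
  ≼-<-trans {a} {b} {c} a≼b b<c with compare a c
  ... | tri< a<c _ _ = a<c
  ... | tri≈ _ refl _ = ⊥-elim (a≼b b<c)
  ... | tri> _ _ c<a = ⊥-elim (a≼b (<-trans b<c c<a))

  ≼-trans : ∀ {a b c} → a ≼ b → b ≼ c → a ≼ c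
  ≼-trans a≼b b≼c = a≼b ∘ ≼-<-trans b≼c

  ≼∧≢⇒< : ∀ {a b} → a ≼ b → ¬ a ≡ b → a < b
  ≼∧≢⇒< {a} {b} a≼b a≢b with compare a b
  ... | tri< a<b _ _ = a<b
  ... | tri≈ _ a≡b _ = ⊥-elim (a≢b a≡b)
  ... | tri> _ _ b<a = ⊥-elim (a≼b b<a)

  nonIncr-tail : ∀ {a l} → NonIncr _<_ (a ∷ l) → NonIncr _<_ l
  nonIncr-tail [ _ ] = []
  nonIncr-tail (cons _ ni) = ni

  nonIncr-head-max : ∀ {a l} → NonIncr _<_ (a ∷ l) → All (_≼ a) l
  nonIncr-head-max [ _ ] = []
  nonIncr-head-max (cons b≼a ni) = b≼a ∷ All.map (λ c≼b → ≼-trans c≼b b≼a) (nonIncr-head-max ni)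

  nonIncr-∷ : ∀ {a l} → All (_≼ a) l → NonIncr _<_ l → NonIncr _<_ (a ∷ l)
  nonIncr-∷ {a} [] [] = [ a ]
  nonIncr-∷ (b≼a ∷ _) ni = cons b≼a ni

  _≺_ : Rel (List Γ) 0ℓ
  _≺_ = _<ᴸ_ _<_

  ≺-asym : Asymmetric _≺_
  ≺-asym nil< ()
  ≺-asym (head< a<b) (head< b<a) = asym a<b b<a
  ≺-asym (head< a<a) (tail< _) = irrefl refl a<a
  ≺-asym (tail< _) (head< a<a) = irrefl refl a<a
  ≺-asym (tail< p) (tail< q) = ≺-asym p q

  ≺-connected : ∀ xs ys → xs ≺ ys ⊎ xs ≡ ys ⊎ ys ≺ xs
  ≺-connected [] [] = inj₂ (inj₁ refl)
  ≺-connected [] (_ ∷ _) = inj₁ nil<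
  ≺-connected (_ ∷ _) [] = inj₂ (inj₂ nil<)
  ≺-connected (x ∷ xs) (y ∷ ys) with compare x y
  ... | tri< x<y _ _ = inj₁ (head< x<y)
  ... | tri> _ _ y<x = inj₂ (inj₂ (head< y<x))
  ... | tri≈ _ refl _ = Sum.map tail< (Sum.map (cong (x ∷_)) tail<) (≺-connected xs ys)

  ≺-++ : ∀ p → (p ++_) Preserves _≺_ ⟶ _≺_
  ≺-++ [] xs≺ys = xs≺ys
  ≺-++ (_ ∷ p) xs≺ys = tail< (≺-++ p xs≺ys)

  CNF : Γ → Set
  CNF β = Σ (List Γ) (IsCNF _<_ β)

  _≺ᶜ_ : ∀ {β} → Rel (CNF β) 0ℓ
  _≺ᶜ_ = _≺_ on proj₁

  0ᶜ : ∀ {β} → CNF β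
  0ᶜ = [] , [] , []

  CNF-⊆ : ∀ {β β'} → (∀ {α} → α < β → α < β') → CNF β → CNF β'
  CNF-⊆ β⊆β' (l , l<β , ni) = l , All.map β⊆β' l<β , ni

  lead<⇒CNF : ∀ {a l γ} → NonIncr _<_ (a ∷ l) → a < γ → CNF γ
  lead<⇒CNF {a} {l} ni a<γ = a ∷ l , a<γ ∷ All.map (λ b≼a → ≼-<-trans b≼a a<γ) (nonIncr-head-max ni) , ni

  CNF-discrete : ∀ {β} → (∀ {α} → ¬ α < β) → ∀ {x y : CNF β} → ¬ x ≺ᶜ y
  CNF-discrete nothing-below {y = _ ∷ _ , b<β ∷ _ , _} _ = nothing-below b<β
  CNF-discrete nothing-below {y = [] , _} ()

  record ωSumDecomposition (β : Γ) : Set where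
    field
      θ          : ℕ → Γ
      θ<β        : ∀ k → θ k < β
      θ-⊆        : ∀ {k k'} → k ℕ.≤ k' → ∀ {α} → α < θ k → α < θ k'
      embed      : L (CNF ∘ θ) (λ _ → _≺ᶜ_) → CNF β
      embed-mono : embed Preserves _<Σ_ (CNF ∘ θ) (λ _ → _≺ᶜ_) ⟶ _≺ᶜ_
      split      : CNF β → L (CNF ∘ θ) (λ _ → _≺ᶜ_)
      split-mono : split Preserves _≺ᶜ_ ⟶ _<Σ_ (CNF ∘ θ) (λ _ → _≺ᶜ_)

  -- ω^(α₀+1) = ω^α₀ · ω: a normal form is α₀ repeated k times followed by a normal form below ω^α₀.
  module _ {β α₀ : Γ} (α₀<β : α₀ < β) (α₀-max : ∀ {α} → α < β → α ≼ α₀) where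

    peel : List Γ → ℕ × List Γ
    peel [] = 0 , []
    peel (a ∷ l) with a ≟ α₀
    ... | yes _ = Product.map₁ ℕ.suc (peel l)
    ... | no _ = 0 , a ∷ l

    peel-CNF : ∀ {l} → IsCNF _<_ β l → IsCNF _<_ α₀ (proj₂ (peel l))
    peel-CNF {[]} _ = [] , []
    peel-CNF {a ∷ l} (a<β ∷ l<β , ni) with a ≟ α₀
    ... | yes _ = peel-CNF (l<β , nonIncr-tail ni)
    ... | no a≢α₀ = proj₂ (lead<⇒CNF ni (≼∧≢⇒< (α₀-max a<β) a≢α₀))

    peel-mono : ∀ {xs ys} → All (_< β) ys → xs ≺ ys → ×-Lex _≡_ ℕ._<_ _≺_ (peel xs) (peel ys)
    peel-mono {ys = b ∷ _} _ nil< with b ≟ α₀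
    ... | yes _ = inj₁ z<s
    ... | no _ = inj₂ (refl , nil<)
    peel-mono {a ∷ _} {b ∷ _} (b<β ∷ _) (head< a<b) with a ≟ α₀ | b ≟ α₀
    ... | yes refl | _ = ⊥-elim (α₀-max b<β a<b)
    ... | no _ | yes _ = inj₁ z<s
    ... | no _ | no _ = inj₂ (refl , head< a<b)
    peel-mono {a ∷ _} (_ ∷ ys<β) (tail< xs≺ys) with a ≟ α₀
    ... | yes _ = Sum.map s<s (Product.map₁ (cong ℕ.suc)) (peel-mono ys<β xs≺ys)
    ... | no _ = inj₂ (refl , tail< xs≺ys)

    prefix-CNF : ∀ k {l} → IsCNF _<_ α₀ l → IsCNF _<_ β (replicate k α₀ ++ l)
    prefix-CNF k {l} (l<α₀ , ni) =
      ++⁺ (replicate⁺ k α₀<β) (All.map (λ a<α₀ → <-trans a<α₀ α₀<β) l<α₀) , prefix-nonIncr k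
      where
      prefix-nonIncr : ∀ k → NonIncr _<_ (replicate k α₀ ++ l)
      prefix-nonIncr zero = ni
      prefix-nonIncr (ℕ.suc k) = nonIncr-∷ (++⁺ (replicate⁺ k ≼-refl) (All.map <⇒≼ l<α₀)) (prefix-nonIncr k)

    prefix-cross : ∀ {k k' xs ys} → All (_< α₀) xs → k ℕ.< k' →
                   (replicate k α₀ ++ xs) ≺ (replicate k' α₀ ++ ys)
    prefix-cross {zero} {xs = []} _ z<s = nil<
    prefix-cross {zero} {xs = _ ∷ _} (a<α₀ ∷ _) z<s = head< a<α₀
    prefix-cross {ℕ.suc _} xs<α₀ (s<s k<k') = tail< (prefix-cross xs<α₀ k<k')

    successor-decomposition : ωSumDecomposition β
    successor-decomposition = record
      { θ = λ _ → α₀ ; θ<β = λ _ → α₀<β ; θ-⊆ = λ _ → id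
      ; embed = embed ; embed-mono = embed-mono ; split = split ; split-mono = split-mono }
      where
      embed : L (λ _ → CNF α₀) (λ _ → _≺ᶜ_) → CNF β
      embed (k , l , l-CNF) = replicate k α₀ ++ l , prefix-CNF k l-CNF
      embed-mono : embed Preserves _<Σ_ (λ _ → CNF α₀) (λ _ → _≺ᶜ_) ⟶ _≺ᶜ_
      embed-mono {_ , _ , xs<α₀ , _} (diff k<k') = prefix-cross xs<α₀ k<k'
      embed-mono {k , _} (same xs≺ys) = ≺-++ (replicate k α₀) xs≺ys
      split : CNF β → L (λ _ → CNF α₀) (λ _ → _≺ᶜ_)
      split (l , l-CNF) = proj₁ (peel l) , proj₂ (peel l) , peel-CNF l-CNF
      ×-Lex⇒<Σ : ∀ {k k'} {u v : CNF α₀} → ×-Lex _≡_ ℕ._<_ _≺_ (k , proj₁ u) (k' , proj₁ v) →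
                 _<Σ_ (λ _ → CNF α₀) (λ _ → _≺ᶜ_) (k , u) (k' , v)
      ×-Lex⇒<Σ (inj₁ k<k') = diff k<k'
      ×-Lex⇒<Σ (inj₂ (refl , u≺v)) = same u≺v
      split-mono : split Preserves _≺ᶜ_ ⟶ _<Σ_ (λ _ → CNF α₀) (λ _ → _≺ᶜ_)
      split-mono {y = _ , y<β , _} x≺y = ×-Lex⇒<Σ (peel-mono y<β x≺y)

  module Indivisibility (em : ExcludedMiddle (suc 0ℓ)) where
    open Classical em

    decomposition-indivisible : ∀ {β} → ωSumDecomposition β →
      (∀ {α} → α < β → Indivisible (_≺ᶜ_ {α})) → Indivisible (_≺ᶜ_ {β})
    decomposition-indivisible decomposition ih =
      equimorphic-indivisible split split-mono embed embed-mono
        (sum-indivisible (λ k → ih (θ<β k)))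
      where
      open ωSumDecomposition decomposition
      open OmegaSum (CNF ∘ θ) (λ _ → _≺ᶜ_) (λ k≤k' → CNF-⊆ (θ-⊆ k≤k')) (λ _ → id)

    module _ (code : Γ → ℕ) (code-inj : ∀ α β → code α ≡ code β → α ≡ β) where

      -- For limit β and B cofinal in β, ω^β is the union of the ω^(B k), and prepending B k embeds ω^(B k)
      -- into ω^β above the images of all ω^(B j) with j < k.
      module _ {β : Γ} (nonzero : ∃ (_< β)) (unbounded : ∀ {α} → α < β → ∃ λ α' → α < α' × α' < β) where

        above : (a b : ∃ (_< β)) → Σ (∃ (_< β)) λ c → proj₁ a < proj₁ c × proj₁ b < proj₁ c
        above (a , a<β) (b , b<β) with compare a b
        ... | tri< a<b _ _ = let (c , b<c , c<β) = unbounded b<β in (c , c<β) , <-trans a<b b<c , b<c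
        ... | tri≈ _ refl _ = let (c , a<c , c<β) = unbounded a<β in (c , c<β) , a<c , a<c
        ... | tri> _ _ b<a = let (c , a<c , c<β) = unbounded a<β in (c , c<β) , a<c , <-trans b<a a<c

        coded : ℕ → ∃ (_< β) → ∃ (_< β)
        coded k fallback with decide (∃ λ α → code α ≡ k × α < β)
        ... | yes (α , _ , α<β) = α , α<β
        ... | no _ = fallback

        coded-code : ∀ {α} fallback → α < β → proj₁ (coded (code α) fallback) ≡ α
        coded-code {α} fallback α<β with decide (∃ λ α' → code α' ≡ code α × α' < β)
        ... | yes (α' , same-code , _) = code-inj α' α same-code
        ... | no none = ⊥-elim (none (α , refl , α<β))

        -- B (k+1) lies above B k and above the element coded by k, so B is increasing and cofinal in β.
        B′ : ℕ → ∃ (_< β)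
        B′ zero = nonzero
        B′ (ℕ.suc k) = proj₁ (above (B′ k) (coded k (B′ k)))

        B : ℕ → Γ
        B = proj₁ ∘ B′

        B<β : ∀ k → B k < β
        B<β = proj₂ ∘ B′

        B-step : ∀ k → B k < B (ℕ.suc k)
        B-step k = proj₁ (proj₂ (above (B′ k) (coded k (B′ k))))

        coded<B : ∀ k → proj₁ (coded k (B′ k)) < B (ℕ.suc k)
        coded<B k = proj₂ (proj₂ (above (B′ k) (coded k (B′ k))))

        B-cofinal : ∀ {α} → α < β → ∃ λ k → α < B k
        B-cofinal {α} α<β =
          ℕ.suc (code α) , subst (_< B (ℕ.suc (code α))) (coded-code (B′ (code α)) α<β) (coded<B (code α))

        block : ∀ {a} → a < β → ∃ λ k → a < B k × ∀ j → a < B j → k ℕ.≤ j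
        block {a} a<β = least (λ j → a <? B j) (proj₂ (B-cofinal a<β))

        prepend : L (CNF ∘ B) (λ _ → _≺ᶜ_) → CNF β
        prepend (k , l , l<Bk , ni) =
          B k ∷ l , B<β k ∷ All.map (λ a<Bk → <-trans a<Bk (B<β k)) l<Bk , nonIncr-∷ (All.map <⇒≼ l<Bk) ni

        prepend-mono : prepend Preserves _<Σ_ (CNF ∘ B) (λ _ → _≺ᶜ_) ⟶ _≺ᶜ_
        prepend-mono (diff k<k') = head< (chain⇒strictMono {R = _<_} <-trans B B-step k<k')
        prepend-mono (same l≺l') = tail< l≺l'

        assign : CNF β → L (CNF ∘ B) (λ _ → _≺ᶜ_)
        assign ([] , _) = 0 , 0ᶜ
        assign (a ∷ _ , a<β ∷ _ , ni) = proj₁ (block a<β) , lead<⇒CNF ni (proj₁ (proj₂ (block a<β)))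

        assign-mono : assign Preserves _≺ᶜ_ ⟶ _<Σ_ (CNF ∘ B) (λ _ → _≺ᶜ_)
        assign-mono {[] , _} {_ ∷ _ , b<β ∷ _ , _} nil< with block b<β
        ... | zero , _ = same nil<
        ... | ℕ.suc _ , _ = diff z<s
        assign-mono {_ ∷ _ , a<β ∷ _ , _} {_ ∷ _ , b<β ∷ _ , _} (head< a<b) with block a<β | block b<β
        ... | k , _ , k-min | k' , b<Bk' , _ with ℕₚ.m≤n⇒m<n∨m≡n (k-min k' (<-trans a<b b<Bk'))
        ...   | inj₁ k<k' = diff k<k'
        ...   | inj₂ refl = same (head< a<b)
        assign-mono {_ ∷ _ , a<β ∷ _ , _} {_ ∷ _ , a<β′ ∷ _ , _} (tail< l≺l') with block a<β | block a<β′
        ... | k , a<Bk , k-min | k' , a<Bk' , k'-min with ℕₚ.≤-antisym (k-min k' a<Bk') (k'-min k a<Bk)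
        ...   | refl = same (tail< l≺l')

        limit-decomposition : ωSumDecomposition β
        limit-decomposition = record
          { θ = B ; θ<β = B<β ; θ-⊆ = chain⇒segment-⊆ {R = _<_} <-trans B B-step
          ; embed = prepend ; embed-mono = prepend-mono ; split = assign ; split-mono = assign-mono }

      cnf-indivisible : WellFounded _<_ → ∀ β → Indivisible (_≺ᶜ_ {β})
      cnf-indivisible wf = WF.All.wfRec wf (suc 0ℓ) (λ β → Indivisible (_≺ᶜ_ {β})) step
        where
        step : ∀ β → (∀ {α} → α < β → Indivisible (_≺ᶜ_ {α})) → Indivisible (_≺ᶜ_ {β})
        step β ih with decide (∃ (_< β))
        ... | no ¬∃ = discrete-indivisible (λ {x} {y} → CNF-discrete (λ {α} α<β → ¬∃ (α , α<β)) {x} {y})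
        ... | yes nonzero with decide (∃ λ α₀ → α₀ < β × ∀ {α} → α < β → α ≼ α₀)
        ...   | yes (α₀ , α₀<β , α₀-max) = decomposition-indivisible (successor-decomposition α₀<β α₀-max) ih
        ...   | no ¬max = decomposition-indivisible (limit-decomposition nonzero unbounded) ih
          where
          unbounded : ∀ {α} → α < β → ∃ λ α' → α < α' × α' < β
          unbounded {α} α<β = dne λ ¬above → ¬max (α , α<β , λ α'<β α<α' → ¬above (_ , α<α' , α'<β))

module _ (G : Pred (Pred ℕ 0ℓ) 0ℓ) (G-ultra : IsUltrafilter G) where
  open IsUltrafilter G-ultra

  empty∉G : ∀ {X} → (∀ n → ¬ X n) → ¬ G X
  empty∉G X-empty GX = noEmpty (up _ _ (λ {n} Xn → X-empty n Xn) GX)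

  G-∪ : ∀ {X Y} → G (X ∪ Y) → G X ⊎ G Y
  G-∪ {X} {Y} GX∪Y with ultra X | ultra Y
  ... | inj₁ GX | _ = inj₁ GX
  ... | _ | inj₁ GY = inj₂ GY
  ... | inj₂ G∁X | inj₂ G∁Y =
    ⊥-elim (empty∉G (λ _ ((X∪Yn , ¬Xn) , ¬Yn) → [ ¬Xn , ¬Yn ]′ X∪Yn) (inter _ _ (inter _ _ GX∪Y G∁X) G∁Y))

  module _ (nonPrincipal : NonPrincipal G) where

    bounded∉G : ∀ N {X} → (∀ n → N ℕ.≤ n → ¬ X n) → ¬ G X
    bounded∉G zero X-empty = empty∉G (λ n → X-empty n z≤n)
    bounded∉G (ℕ.suc N) {X} X-bounded GX with ultra (_≡ N)
    ... | inj₁ G[N] = nonPrincipal N G[N]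
    ... | inj₂ G∁[N] = bounded∉G N bounded (inter _ _ GX G∁[N])
      where
      bounded : ∀ n → N ℕ.≤ n → ¬ (X ∩ ∁ (_≡ N)) n
      bounded n N≤n (Xn , n≢N) with ℕₚ.m≤n⇒m<n∨m≡n N≤n
      ... | inj₁ N<n = X-bounded n N<n Xn
      ... | inj₂ N≡n = n≢N (sym N≡n)

    nonPrincipal⇒Inf : ∀ {X} → G X → Inf X
    nonPrincipal⇒Inf GX (N , X-bounded) = bounded∉G N X-bounded GX

module SeparativeModification (em : ExcludedMiddle (suc 0ℓ))
  (Ln : ℕ → Set) (_<n_ : ∀ n → Rel (Ln n) 0ℓ) where
  open Classical em

  _∖′_ : Pred (L Ln _<n_) 0ℓ → Pred (L Ln _<n_) 0ℓ → Pred (L Ln _<n_) 0ℓ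
  _∖′_ = _∖_ Ln _<n_

  ∅-∈ : ∀ {ℓ} {𝒳 : Pred (Pred (L Ln _<n_) 0ℓ) ℓ} → IsIdeal 𝒳 → ∀ A → (∀ x → ¬ A x) → 𝒳 A
  ∅-∈ 𝒳-ideal A A-empty = IsIdeal.down 𝒳-ideal _ A (λ {x} Ax → A-empty x Ax) (IsIdeal.empty 𝒳-ideal)

  ⊂-trans : ∀ {ℓ} {𝒳 : Pred (Pred (L Ln _<n_) 0ℓ) ℓ} → IsIdeal 𝒳 →
            ∀ {r p q} → _⊂[_]_ Ln _<n_ r 𝒳 p → _⊂[_]_ Ln _<n_ p 𝒳 q → _⊂[_]_ Ln _<n_ r 𝒳 q
  ⊂-trans 𝒳-ideal {r} {p} {q} r⊂p p⊂q =
    IsIdeal.down 𝒳-ideal _ (r ∖′ q) through-p (IsIdeal.union 𝒳-ideal _ _ r⊂p p⊂q)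
    where
    through-p : r ∖′ q ⊆ (r ∖′ p) ∪ (p ∖′ q)
    through-p {x} (rx , ¬qx) with decide (p x)
    ... | yes px = inj₂ (px , ¬qx)
    ... | no ¬px = inj₁ (rx , ¬px)

  module _ (𝒥 : Pred (Pred (L Ln _<n_) 0ℓ) 0ℓ) (𝒦 : Pred (Pred (L Ln _<n_) 0ℓ) (suc 0ℓ))
    (𝒥-ideal : IsIdeal 𝒥) (𝒦-ideal : IsIdeal 𝒦) (𝒥⊆𝒦 : ∀ A → 𝒥 A → 𝒦 A)
    (separates : ∀ r A → ¬ 𝒦 r → 𝒦 A → Σ (Pred (L Ln _<n_) 0ℓ) λ s → s ⊆ r × ¬ 𝒦 s × 𝒥 (s ∩ A)) where

    sm-⊂⇔⊂ : ∀ p q → sm-≤ (λ r → ¬ 𝒦 r) (λ r s → _⊂[_]_ Ln _<n_ r 𝒥 s) p q ⇔ _⊂[_]_ Ln _<n_ p 𝒦 q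
    sm-⊂⇔⊂ p q = mk⇔ to from
      where
      to : sm-≤ (λ r → ¬ 𝒦 r) (λ r s → _⊂[_]_ Ln _<n_ r 𝒥 s) p q → 𝒦 (p ∖′ q)
      to p≤*q = dne₁ λ p∖q∉𝒦 →
        let (s , s∉𝒦 , s⊂p∖q , s⊂q) = p≤*q (p ∖′ q) p∖q∉𝒦 (∅-∈ 𝒥-ideal _ λ _ ((px , _) , ¬px) → ¬px px)
        in s∉𝒦 (𝒥⊆𝒦 s (IsIdeal.down 𝒥-ideal _ s (cover s) (IsIdeal.union 𝒥-ideal _ _ s⊂p∖q s⊂q)))
        where
        cover : ∀ s → s ⊆ (s ∖′ (p ∖′ q)) ∪ (s ∖′ q)
        cover s {x} sx with decide (q x)
        ... | yes qx = inj₁ (sx , λ (_ , ¬qx) → ¬qx qx)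
        ... | no ¬qx = inj₂ (sx , ¬qx)
      from : 𝒦 (p ∖′ q) → sm-≤ (λ r → ¬ 𝒦 r) (λ r s → _⊂[_]_ Ln _<n_ r 𝒥 s) p q
      from p⊂q r r∉𝒦 r⊂p with separates r (r ∖′ q) r∉𝒦 (⊂-trans 𝒦-ideal (𝒥⊆𝒦 _ r⊂p) p⊂q)
      ... | s , s⊆r , s∉𝒦 , s∩r∖q∈𝒥 =
        s , s∉𝒦 , ∅-∈ 𝒥-ideal _ (λ _ (sx , ¬rx) → ¬rx (s⊆r sx)) ,
        IsIdeal.down 𝒥-ideal _ _ (λ (sx , ¬qx) → sx , s⊆r sx , ¬qx) s∩r∖q∈𝒥

module OrderedSum (em : ExcludedMiddle (suc 0ℓ))
  {Γ : Set} {_<_ : Rel Γ 0ℓ} (sto : IsStrictTotalOrder _≡_ _<_) (wf : WellFounded _<_)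
  (code : Γ → ℕ) (code-inj : ∀ α β → code α ≡ code β → α ≡ β)
  (δ : ℕ → Γ) (δ-step : ∀ n → δ n < δ (ℕ.suc n))
  (Ln : ℕ → Set) (_<n_ : ∀ n → Rel (Ln n) 0ℓ)
  (iso : ∀ n → IsoToOmegaPow _<_ (Ln n) (_<n_ n) (δ n)) where

  open IsStrictTotalOrder sto using () renaming (trans to <-trans)
  open Classical em
  open CantorNormalForm sto
  open Indivisibility em
  open SumOrder {Ln} {_<n_}
  open SeparativeModification em Ln _<n_ using (_∖′_)
  module Iso n = IsoToOmegaPow (iso n)

  toCNF : ∀ n → Ln n → CNF (δ n)
  toCNF n x = Iso.φ n x , Iso.into n x

  fromCNF : ∀ n → CNF (δ n) → Ln n
  fromCNF n (l , l-CNF) = proj₁ (Iso.onto n l l-CNF)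

  fromCNF-mono : ∀ {n} → fromCNF n Preserves _≺ᶜ_ ⟶ _<n_ n
  fromCNF-mono {n} {l , l-CNF} {l' , l'-CNF} l≺l' =
    Iso.reflect n _ _ (subst₂ _≺_ (sym (proj₂ (Iso.onto n l l-CNF))) (sym (proj₂ (Iso.onto n l' l'-CNF))) l≺l')

  liftCNF : ∀ {k k'} → k ℕ.≤ k' → Ln k → CNF (δ k')
  liftCNF k≤k' = CNF-⊆ (chain⇒segment-⊆ {R = _<_} <-trans δ δ-step k≤k') ∘ toCNF _

  widen : ∀ {k k'} → k ℕ.≤ k' → Ln k → Ln k'
  widen k≤k' = fromCNF _ ∘ liftCNF k≤k'

  widen-mono : ∀ {k k'} (k≤k' : k ℕ.≤ k') → widen k≤k' Preserves _<n_ k ⟶ _<n_ k'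
  widen-mono {k} {k'} k≤k' {x} {y} x<y =
    fromCNF-mono {k'} {liftCNF k≤k' x} {liftCNF k≤k' y} (Iso.preserve k x y x<y)

  open Classical.OmegaSum em Ln _<n_ widen widen-mono

  𝕃-indivisible : Indivisible (_<Σ_ Ln _<n_)
  𝕃-indivisible = sum-indivisible λ n →
    equimorphic-indivisible (toCNF n) (Iso.preserve n _ _) (fromCNF n) fromCNF-mono
      (cnf-indivisible code code-inj wf (δ n))

  <n-connected : ∀ {n} (x y : Ln n) → _<n_ n x y ⊎ x ≡ y ⊎ _<n_ n y x
  <n-connected {n} x y =
    Sum.map (Iso.reflect n x y) (Sum.map (Iso.injective n x y) (Iso.reflect n y x))
      (≺-connected (Iso.φ n x) (Iso.φ n y))

  <n-asym : ∀ {n} → Asymmetric (_<n_ n)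
  <n-asym {n} {x} {y} x<y y<x = ≺-asym (Iso.preserve n x y x<y) (Iso.preserve n y x y<x)

  selfEmbedding⇒Embeds : ∀ {A} → SelfEmbedding (_<Σ_ Ln _<n_) A → Embeds Ln _<n_ A
  selfEmbedding⇒Embeds (f , f-mono , f-in) =
    f , (λ _ _ → f-mono) , (λ x y → reflects {x} {y}) , f-in
    where
    reflects = strictMono⇒reflects {_<B_ = _<Σ_ Ln _<n_} (<Σ-connected <n-connected) (<Σ-asym <n-asym) f f-mono

  𝓘-∪ : ∀ A B → 𝓘 Ln _<n_ A → 𝓘 Ln _<n_ B → 𝓘 Ln _<n_ (A ∪ B)
  𝓘-∪ A B A∈𝓘 B∈𝓘 (f , f-mono , _ , f-in) with 𝕃-indivisible (A ∘ f)
  ... | inj₁ (e , e-mono , e-in) =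
    A∈𝓘 (selfEmbedding⇒Embeds {A} (f ∘ e , (λ x<y → f-mono _ _ (e-mono x<y)) , e-in))
  ... | inj₂ (e , e-mono , e-out) =
    B∈𝓘 (selfEmbedding⇒Embeds {B} (f ∘ e , (λ x<y → f-mono _ _ (e-mono x<y)) ,
      λ x → [ ⊥-elim ∘ e-out x , id ]′ (f-in (e x))))

  𝓘-isIdeal : IsIdeal (𝓘 Ln _<n_)
  𝓘-isIdeal = record
    { empty = λ (f , _ , _ , f-in) → f-in (0 , fromCNF 0 0ᶜ)
    ; down = λ _ _ B⊆A A∈𝓘 (f , f-mono , f-reflect , f-in) → A∈𝓘 (f , f-mono , f-reflect , B⊆A ∘ f-in)
    ; union = 𝓘-∪
    ; proper = λ L∈𝓘 → L∈𝓘 (id , (λ _ _ → id) , (λ _ _ → id) , _)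
    }

  module ModuloUltrafilter (G : Pred (Pred ℕ 0ℓ) 0ℓ) (G-ultra : IsUltrafilter G)
    (G-nonPrincipal : NonPrincipal G) where
    open IsUltrafilter G-ultra

    𝓘[G] : Pred (Pred (L Ln _<n_) 0ℓ) (suc 0ℓ)
    𝓘[G] = 𝓘[_] Ln _<n_ G

    𝓘⊆𝓘[G] : ∀ A → 𝓘 Ln _<n_ A → 𝓘[G] A
    𝓘⊆𝓘[G] A A∈𝓘 = A , A∈𝓘 , empty∉G G G-ultra λ _ (_ , Ax , ¬Ax) → ¬Ax Ax

    𝓘[G]-proper : ¬ 𝓘[G] (λ _ → ⊤)
    𝓘[G]-proper (I , I∈𝓘 , L∖I∉G) with ultra (supp Ln _<n_ ((λ _ → ⊤) ∖′ I))
    ... | inj₁ G[L∖I] = L∖I∉G G[L∖I]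
    ... | inj₂ G∁[L∖I] = I∈𝓘 (selfEmbedding⇒Embeds {I} (Inf-summands⇒SelfEmbedding I summands⊆I))
      where
      summands⊆I : Inf (SummandEmbeds I)
      summands⊆I = InfinitelyOften.map {Q = SummandEmbeds I}
        (λ ∉supp → id , id , λ x → dne λ ¬Ix → ∉supp (x , tt , ¬Ix))
        (nonPrincipal⇒Inf G G-ultra G-nonPrincipal G∁[L∖I])

    𝓘[G]-isIdeal : IsIdeal 𝓘[G]
    𝓘[G]-isIdeal = record
      { empty = (λ _ → ⊥) , IsIdeal.empty 𝓘-isIdeal , empty∉G G G-ultra λ { _ (_ , () , _) }
      ; down = λ A B B⊆A (I , I∈𝓘 , A∖I∉G) →
          I , I∈𝓘 , λ G[B∖I] → A∖I∉G (up _ _ (λ (x , Bx , ¬Ix) → x , B⊆A Bx , ¬Ix) G[B∖I])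
      ; union = λ A B (I , I∈𝓘 , A∖I∉G) (J , J∈𝓘 , B∖J∉G) →
          I ∪ J , 𝓘-∪ I J I∈𝓘 J∈𝓘 ,
          λ G[A∪B∖I∪J] → [ A∖I∉G , B∖J∉G ]′ (G-∪ G G-ultra (up _ _ (λ where
            (x , inj₁ Ax , ¬I∪J) → inj₁ (x , Ax , ¬I∪J ∘ inj₁)
            (x , inj₂ Bx , ¬I∪J) → inj₂ (x , Bx , ¬I∪J ∘ inj₂)) G[A∪B∖I∪J]))
      ; proper = 𝓘[G]-proper
      }

    𝓘[G]-separates : ∀ r A → ¬ 𝓘[G] r → 𝓘[G] A →
                     Σ (Pred (L Ln _<n_) 0ℓ) λ s → s ⊆ r × ¬ 𝓘[G] s × 𝓘 Ln _<n_ (s ∩ A)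
    𝓘[G]-separates r A r∉𝓘[G] (K , K∈𝓘 , Y∉G) =
      s , proj₁ , s∉𝓘[G] , IsIdeal.down 𝓘-isIdeal K (s ∩ A) s∩A⊆K K∈𝓘
      where
      Y : Pred ℕ 0ℓ
      Y = supp Ln _<n_ (A ∖′ K)
      s r|Y : Pred (L Ln _<n_) 0ℓ
      s (n , x) = r (n , x) × ¬ Y n
      r|Y (n , x) = r (n , x) × Y n
      s∩A⊆K : s ∩ A ⊆ K
      s∩A⊆K {n , x} ((_ , ¬Yn) , Ax) = dne λ ¬Kx → ¬Yn (x , Ax , ¬Kx)
      r|Y∈𝓘[G] : 𝓘[G] r|Y
      r|Y∈𝓘[G] = (λ _ → ⊥) , IsIdeal.empty 𝓘-isIdeal ,
                 λ G[r|Y] → Y∉G (up _ _ (λ (_ , (_ , Yn) , _) → Yn) G[r|Y])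
      cover : r ⊆ s ∪ r|Y
      cover {n , x} rx with decide (Y n)
      ... | yes Yn = inj₂ (rx , Yn)
      ... | no ¬Yn = inj₁ (rx , ¬Yn)
      s∉𝓘[G] : ¬ 𝓘[G] s
      s∉𝓘[G] s∈𝓘[G] =
        r∉𝓘[G] (IsIdeal.down 𝓘[G]-isIdeal _ r cover (IsIdeal.union 𝓘[G]-isIdeal _ _ s∈𝓘[G] r|Y∈𝓘[G]))

lemma4p4 :
  -- classical ambient logic (the paper works in ZFC)
  ExcludedMiddle (suc 0ℓ) →
  -- γ : a countable limit ordinal, given as a countable well-order Γ
  (Γ : Set) (_<_ : Rel Γ 0ℓ) → IsStrictTotalOrder _≡_ _<_ → WellFounded _<_ →
  (code : Γ → ℕ) → (∀ α β → code α ≡ code β → α ≡ β) →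
  Γ → (∀ α → Σ Γ (λ β → α < β)) →
  -- ⟨δ_n : n ∈ ω⟩ increasing and cofinal in γ ∖ {0}
  (δ : ℕ → Γ) → (∀ n → δ n < δ (ℕ.suc n)) →
  (∀ n → Σ Γ (λ α → α < δ n)) → (∀ α → Σ ℕ (λ n → α < δ n)) →
  -- the summands ⟨L_n,<_n⟩ ≅ ⟨ω^δ_n , ∈⟩
  (Ln : ℕ → Set) (_<n_ : ∀ n → Rel (Ln n) 0ℓ) →
  (∀ n → IsoToOmegaPow _<_ (Ln n) (_<n_ n) (δ n)) →
  -- G ⊂ P(ω) a (non-principal) ultrafilter
  (G : Pred (Pred ℕ 0ℓ) 0ℓ) → IsUltrafilter G → NonPrincipal G →
  -- (a)
  (IsIdeal (𝓘[_] Ln _<n_ G) × (∀ A → 𝓘 Ln _<n_ A → 𝓘[_] Ln _<n_ G A))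
  ×
  -- (b)  sm ⟨P(L) ∖ 𝓘_G , ⊂_𝓘⟩ = ⟨P(L) ∖ 𝓘_G , ⊂_{𝓘_G}⟩
  (∀ (p q : Pred (L Ln _<n_) 0ℓ) → ¬ 𝓘[_] Ln _<n_ G p → ¬ 𝓘[_] Ln _<n_ G q →
    (sm-≤ (λ r → ¬ 𝓘[_] Ln _<n_ G r) (λ r s → _⊂[_]_ Ln _<n_ r (𝓘 Ln _<n_) s) p q
      ⇔ _⊂[_]_ Ln _<n_ p (𝓘[_] Ln _<n_ G) q))
lemma4p4 em Γ _<_ sto wf code code-inj _ _ δ δ-step _ _ Ln _<n_ iso G G-ultra G-nonPrincipal =
  (𝓘[G]-isIdeal , 𝓘⊆𝓘[G]) ,
  λ p q _ _ → sm-⊂⇔⊂ (𝓘 Ln _<n_) 𝓘[G] 𝓘-isIdeal 𝓘[G]-isIdeal 𝓘⊆𝓘[G] 𝓘[G]-separates p q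
  where
  open OrderedSum em sto wf code code-inj δ δ-step Ln _<n_ iso
  open ModuloUltrafilter G G-ultra G-nonPrincipal
  open SeparativeModification em Ln _<n_ using (sm-⊂⇔⊂)
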